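{- Let $\Sigma$ be a signed graph and let $v$ be a negative dominating vertex of $\Sigma$. Then \[ \mathsf E(\Sigma,x,y)=y\,\mathsf E(\Sigma\setminus v,x,y)+(x-y)\,\mathsf E(\Sigma\setminus v,x-1,y+1), \] \[ \mathsf O(\Sigma,x,y)=y\,\mathsf O(\Sigma\setminus v,x,y)+(x-y-1)\,\mathsf O(\Sigma\setminus v,x-1,y+1)+\mathsf E(\Sigma\setminus v,x-1,y). \]
   Context: A signed graph $\Sigma=(\Gamma,\sigma)$ is a finite simple graph $\Gamma$ with a signature $\sigma:E(\Gamma)\to\{\pm1\}$. A vertex $v$ is a negative dominating vertex if it is joined by a negative edge to every other vertex; the single vertex of the one-vertex graph $K_1$ counts as a negative dominating vertex. $\Sigma\setminus v$ is obtained by deleting $v$ and its incident edges (the vertexless graph $K_0$ has $\mathsf E(K_0,x,y)=\mathsf O(K_0,x,y)=1$). For a finite $C\subseteq\mathbb Z$, a proper $C$-colouring of $\Sigma$ is a map $\kappa:V(\Gamma)\to C$ with $\kappa(v)\ne\sigma(\{v,w\})\kappa(w)$ for every edge $\{v,w\}$. For integers $\lambda\ge\mu\ge0$, a finite $C\subseteq\mathbb Z$ is a $(\lambda,\mu)$-colour set if there are disjoint sets $P,U$ of nonzero integers with $-P=P$, $|U|=\mu$, $(-U)\cap U=\varnothing$, and either $\lambda-\mu$ even, $|P|=\lambda-\mu$, $C=P\cup U$, or $\lambda-\mu$ odd, $|P|=\lambda-\mu-1$, $C=P\cup U\cup\{0\}$. $f(\Sigma,\lambda,\mu)$ is the number of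 proper $C$-colourings for any $(\lambda,\mu)$-colour set $C$ (independent of $C$). $\mathsf E(\Sigma,x,y),\mathsf O(\Sigma,x,y)\in\mathbb Z[x,y]$ are the unique polynomials with $f(\Sigma,\lambda,\mu)=\mathsf E(\Sigma,\lambda,\mu)$ for all integers $\lambda\ge\mu\ge0$ with $\lambda-\mu$ even and $f(\Sigma,\lambda,\mu)=\mathsf O(\Sigma,\lambda,\mu)$ whenever $\lambda-\mu$ is odd. The identities are equalities in $\mathbb Z[x,y]$. -}

module Defs where

open import Data.Nat using (ℕ; zero; suc; _≤_; _∸_; _%_)
open import Data.Integer using (ℤ; _+_; _*_; -_; 0ℤ; 1ℤ; -1ℤ; _≟_)
open import Data.Fin using (Fin; punchIn)
open import Data.Fin.Properties using (all?)
open import Data.Sign using (Sign)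
open import Data.Maybe using (Maybe; just; nothing)
open import Data.List using (List; []; _∷_; length; filter; map; concatMap)
open import Data.List.Membership.Propositional using (_∈_; _∉_)
open import Data.List.Relation.Unary.All using (All)
open import Data.List.Relation.Unary.Unique.Propositional using (Unique)
open import Data.Vec using (Vec; lookup) renaming ([] to []ᵥ; _∷_ to _∷ᵥ_)
open import Data.Unit using (⊤; tt)
open import Data.Product using (_×_)
open import Data.Sum using (_⊎_)
open import Function.Bundles using (_⇔_)
open import Relation.Nullary using (Dec; yes; no; ¬?)
open import Relation.Binary.PropositionalEquality using (_≡_; _≢_)

-- Signed graphs on vertex set Fin n.
-- edge i j = nothing : no edge; edge i j = just s : an edge of sign s.
-- Simple: loopless and symmetric (undirected, at most one edge per pair).

record SignedGraph (n : ℕ) : Set where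
  field
    edge  : Fin n → Fin n → Maybe Sign
    symmetric : ∀ i j → edge i j ≡ edge j i
    loopless : ∀ i → edge i i ≡ nothing
open SignedGraph public

deleteVertex : ∀ {n} → SignedGraph (suc n) → Fin (suc n) → SignedGraph n
deleteVertex Σ v = record
  { edge     = λ i j → edge Σ (punchIn v i) (punchIn v j)
  ; symmetric = λ i j → symmetric Σ (punchIn v i) (punchIn v j)
  ; loopless = λ i → loopless Σ (punchIn v i)
  }

NegDominating : ∀ {n} → SignedGraph n → Fin n → Set
NegDominating Σ v = ∀ w → w ≢ v → edge Σ v w ≡ just Sign.-

sgn : Sign → ℤ
sgn Sign.+ = 1ℤ
sgn Sign.- = -1ℤ

EdgeOK : Maybe Sign → ℤ → ℤ → Set
EdgeOK nothing  a b = ⊤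
EdgeOK (just s) a b = a ≢ sgn s * b

edgeOK? : ∀ m a b → Dec (EdgeOK m a b)
edgeOK? nothing  a b = yes tt
edgeOK? (just s) a b = ¬? (a ≟ sgn s * b)

Proper : ∀ {n} → SignedGraph n → (Fin n → ℤ) → Set
Proper Σ κ = ∀ i j → EdgeOK (edge Σ i j) (κ i) (κ j)

proper? : ∀ {n} (Σ : SignedGraph n) (κ : Fin n → ℤ) → Dec (Proper Σ κ)
proper? Σ κ = all? (λ i → all? (λ j → edgeOK? (edge Σ i j) (κ i) (κ j)))

allMaps : List ℤ → (n : ℕ) → List (Vec ℤ n)
allMaps C zero    = []ᵥ ∷ []
allMaps C (suc n) = concatMap (λ c → map (c ∷ᵥ_) (allMaps C n)) C

-- number of proper C-colourings (C given as a duplicate-free list)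
numColourings : ∀ {n} → SignedGraph n → List ℤ → ℕ
numColourings {n} Σ C = length (filter (λ κ → proper? Σ (lookup κ)) (allMaps C n))

record ColourSet (l m : ℕ) (C : List ℤ) : Set where
  field
    P U       : List ℤ
    C-unique  : Unique C
    P-unique  : Unique P
    U-unique  : Unique U
    P-nonzero : All (_≢ 0ℤ) P
    U-nonzero : All (_≢ 0ℤ) U
    P-neg     : ∀ {a} → a ∈ P → - a ∈ P
    P-U-disj  : ∀ {a} → a ∈ P → a ∉ U
    U-neg     : ∀ {a} → a ∈ U → - a ∉ U
    U-size    : length U ≡ m
    shape     :
      ( (l ∸ m) % 2 ≡ 0 × length P ≡ l ∸ m
        × (∀ c → (c ∈ C) ⇔ (c ∈ P ⊎ c ∈ U)) )
      ⊎
      ( (l ∸ m) % 2 ≡ 1 × length P ≡ l ∸ m ∸ 1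
        × (∀ c → (c ∈ C) ⇔ (c ∈ P ⊎ c ∈ U ⊎ c ≡ 0ℤ)) )

-- Polynomials in ℤ[x,y]: coefficient lists, p = Σᵢ xⁱ (Σⱼ cᵢⱼ yʲ)

Poly2 : Set
Poly2 = List (List ℤ)

evalY : List ℤ → ℤ → ℤ
evalY []       y = 0ℤ
evalY (c ∷ cs) y = c + y * evalY cs y

eval : Poly2 → ℤ → ℤ → ℤ
eval []       x y = 0ℤ
eval (q ∷ qs) x y = evalY q y + x * eval qs x y

-- E is "the" polynomial E(Σ,x,y): it agrees with f(Σ,λ,μ) whenever λ ≥ μ ≥ 0, λ-μ even
IsE : ∀ {n} → SignedGraph n → Poly2 → Set
IsE Σ E = ∀ (l m : ℕ) → m ≤ l → (l ∸ m) % 2 ≡ 0 →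
          ∀ C → ColourSet l m C → ℤ.pos (numColourings Σ C) ≡ eval E (ℤ.pos l) (ℤ.pos m)

IsO : ∀ {n} → SignedGraph n → Poly2 → Set
IsO Σ O = ∀ (l m : ℕ) → m ≤ l → (l ∸ m) % 2 ≡ 1 →
          ∀ C → ColourSet l m C → ℤ.pos (numColourings Σ C) ≡ eval O (ℤ.pos l) (ℤ.pos m)

{-# OPTIONS --safe #-}
module Submission where

open import Defs
open import Data.Nat using (ℕ; suc)
open import Data.Fin using (Fin)
open import Data.Integer using (ℤ; _+_; _-_; _*_; 1ℤ)
open import Relation.Binary.PropositionalEquality using (_≡_)
open import Data.Product using (_×_)
open import Data.Nat.Base using (s≤s; z≤n)
open import Data.Product.Base using (_,_)
open import Relation.Binary.PropositionalEquality using (sym; trans)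

-- Colour the dominating vertex v first. Since v is joined negatively to every
-- other vertex, the proper colourings of Σ with κ(v) = c are exactly the proper
-- colourings of Σ ∖ v that avoid -c, so f(Σ, C) = Σ_{c ∈ C} f(Σ ∖ v, C ∖ {-c}).
-- For c ∈ U the colour -c is not in C; for c ∈ P deleting -c leaves c unpaired,
-- giving a (λ-1, μ+1)-colour set; for c = 0 (λ-μ odd) deleting 0 gives a
-- (λ-1, μ)-colour set. Counting |U| = μ and |P| = λ-μ (resp. λ-μ-1) proves both
-- identities at every integer point (λ, μ) with λ ≥ μ ≥ 0 of the right parity.
-- Both sides are polynomials in each variable, and such a function vanishing on
-- these points vanishes everywhere: in each row y = μ the points form an arithmetic
-- progression of step 2, and a polynomial vanishing on such a progression is zero
-- by induction on its degree, using finite differences.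

module PolynomialFunction where
  open import Data.Nat.Base as ℕ using (zero; _≤_; _⊔_; _∸_; _%_; _<_)
  import Data.Nat.Properties as ℕ
  import Data.Nat.Tactic.RingSolver as ℕ
  open import Data.Nat.DivMod using ([m+kn]%n≡m%n; m<n⇒m%n≡m)
  open import Data.Integer.Base using (+_; -[1+_]; 0ℤ; -1ℤ)
  import Data.Integer.Properties as ℤ
  open import Data.Integer.Tactic.RingSolver using (solve-∀)
  open import Data.List.Base using ([]; _∷_)
  open import Data.Product.Base using (∃; _,_; proj₂)
  open import Relation.Binary.PropositionalEquality

  private
    variable
      d e : ℕ
      f g h : ℤ → ℤ
      F G : ℤ → ℤ → ℤ

  -- The step is added on the left so that 1ℤ + + n and + 2 + + n compute to + suc n and
  -- + suc (suc n), which keeps the inductions over ℤ and along progressions definitional.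
  Δ : (ℤ → ℤ) → ℤ → ℤ
  Δ g x = g (1ℤ + x) - g x

  data DegreeAtMost : ℕ → (ℤ → ℤ) → Set where
    constant   : (∀ x → g x ≡ g 0ℤ) → DegreeAtMost zero g
    difference : DegreeAtMost d (Δ g) → DegreeAtMost (suc d) g

  IsPolynomial : (ℤ → ℤ) → Set
  IsPolynomial g = ∃ λ d → DegreeAtMost d g

  private
    Δ-+ : ∀ a b c d → (a + b) - (c + d) ≡ (a - c) + (b - d)
    Δ-+ = solve-∀
    Δ-scale : ∀ c a b → c * (a - b) ≡ c * a - c * b
    Δ-scale = solve-∀
    Δ-* : ∀ a b c d → a * b - c * d ≡ a * (b - d) + (a - c) * d
    Δ-* = solve-∀
    Δ-id : ∀ x → 1ℤ + x - x ≡ 1ℤ + 0ℤ - 0ℤ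
    Δ-id = solve-∀
    +-shift : ∀ c x → c + (1ℤ + x) ≡ 1ℤ + (c + x)
    +-shift = solve-∀
    telescope : ∀ a b c → a - c ≡ (a - b) + (b - c)
    telescope = solve-∀

  degree-cong : (∀ x → g x ≡ h x) → DegreeAtMost d g → DegreeAtMost d h
  degree-cong g≗h (constant gc)   = constant (λ x → trans (sym (g≗h x)) (trans (gc x) (g≗h 0ℤ)))
  degree-cong g≗h (difference dg) = difference (degree-cong (λ x → cong₂ _-_ (g≗h (1ℤ + x)) (g≗h x)) dg)

  degree-const : ∀ d c → DegreeAtMost d (λ _ → c)
  degree-const zero    c = constant (λ _ → refl)
  degree-const (suc d) c = difference (degree-cong (λ _ → sym (ℤ.+-inverseʳ c)) (degree-const d 0ℤ))

  degree-suc : DegreeAtMost d g → DegreeAtMost (suc d) g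
  degree-suc {g = g} (constant gc) = difference (constant (λ x → trans (Δg≡0 x) (sym (Δg≡0 0ℤ))))
    where
    Δg≡0 : ∀ x → Δ g x ≡ 0ℤ
    Δg≡0 x = trans (cong₂ _-_ (gc (1ℤ + x)) (gc x)) (ℤ.+-inverseʳ (g 0ℤ))
  degree-suc (difference dg) = difference (degree-suc dg)

  degree-mono : d ≤ e → DegreeAtMost d g → DegreeAtMost e g
  degree-mono {e = zero}  ℕ.z≤n       dg              = dg
  degree-mono {e = suc e} ℕ.z≤n       dg              = degree-suc (degree-mono ℕ.z≤n dg)
  degree-mono             (ℕ.s≤s d≤e) (difference dg) = difference (degree-mono d≤e dg)

  degree-+ : DegreeAtMost d f → DegreeAtMost d g → DegreeAtMost d (λ x → f x + g x)
  degree-+ (constant fc) (constant gc) = constant (λ x → cong₂ _+_ (fc x) (gc x))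
  degree-+ {f = f} {g = g} (difference df) (difference dg) =
    difference (degree-cong (λ x → sym (Δ-+ (f (1ℤ + x)) (g (1ℤ + x)) (f x) (g x))) (degree-+ df dg))

  degree-scale : ∀ c → DegreeAtMost d g → DegreeAtMost d (λ x → c * g x)
  degree-scale c (constant gc) = constant (λ x → cong (c *_) (gc x))
  degree-scale {g = g} c (difference dg) =
    difference (degree-cong (λ x → Δ-scale c (g (1ℤ + x)) (g x)) (degree-scale c dg))

  degree-shift : ∀ c → DegreeAtMost d g → DegreeAtMost d (λ x → g (c + x))
  degree-shift c (constant gc) = constant (λ x → trans (gc (c + x)) (sym (gc (c + 0ℤ))))
  degree-shift {g = g} c (difference dg) =
    difference (degree-cong (λ x → cong (λ z → g z - g (c + x)) (sym (+-shift c x))) (degree-shift c dg))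

  degree-id : DegreeAtMost 1 (λ x → x)
  degree-id = difference (constant Δ-id)

  -- Δ(f g)(x) = f(1 + x) Δg(x) + Δf(x) g(x); the recursion is lexicographic in the two degrees.
  degree-* : DegreeAtMost d f → DegreeAtMost e g → DegreeAtMost (d ℕ.+ e) (λ x → f x * g x)
  degree-* {f = f} {g = g} (constant fc) dg =
    degree-cong (λ x → cong (_* g x) (sym (fc x))) (degree-scale (f 0ℤ) dg)
  degree-* {d = suc d} {f = f} {g = g} df (constant gc) =
    degree-mono (ℕ.m≤m+n (suc d) 0)
      (degree-cong (λ x → trans (ℤ.*-comm (g 0ℤ) (f x)) (cong (f x *_) (sym (gc x)))) (degree-scale (g 0ℤ) df))
  degree-* {d = suc d} {f = f} {e = suc e} {g = g} df@(difference Δdf) dg@(difference Δdg) =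
    difference (degree-cong (λ x → sym (Δ-* (f (1ℤ + x)) (g (1ℤ + x)) (f x) (g x)))
      (degree-+ (degree-mono (ℕ.≤-reflexive (sym (ℕ.+-suc d e))) (degree-* (degree-shift 1ℤ df) Δdg))
                (degree-* Δdf dg)))

  Δ≡0⇒constant : (∀ x → Δ g x ≡ 0ℤ) → ∀ x → g x ≡ g 0ℤ
  Δ≡0⇒constant {g} Δg≡0 (+ zero)      = refl
  Δ≡0⇒constant {g} Δg≡0 (+ suc n)     =
    trans (ℤ.i-j≡0⇒i≡j _ _ (Δg≡0 (+ n))) (Δ≡0⇒constant {g} Δg≡0 (+ n))
  Δ≡0⇒constant {g} Δg≡0 -[1+ zero ]  = sym (ℤ.i-j≡0⇒i≡j _ _ (Δg≡0 -[1+ zero ]))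
  Δ≡0⇒constant {g} Δg≡0 -[1+ suc n ] =
    trans (sym (ℤ.i-j≡0⇒i≡j _ _ (Δg≡0 -[1+ suc n ]))) (Δ≡0⇒constant {g} Δg≡0 -[1+ n ])

  double≡0⇒≡0 : ∀ a → a + a ≡ 0ℤ → a ≡ 0ℤ
  double≡0⇒≡0 (+ zero)  _  = refl
  double≡0⇒≡0 (+ suc _) ()
  double≡0⇒≡0 -[1+ _ ]  ()

  -- Δg is periodic of lower degree, hence constant; then g(2) - g(0) = 2 Δg(0) forces Δg = 0.
  periodic⇒constant : DegreeAtMost d g → (∀ x → g (+ 2 + x) ≡ g x) → ∀ x → g x ≡ g 0ℤ
  periodic⇒constant (constant gc) _ = gc
  periodic⇒constant {g = g} (difference dg) period = Δ≡0⇒constant (λ x → trans (Δg-constant x) Δg0≡0)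
    where
    open ≡-Reasoning
    Δg-constant : ∀ x → Δ g x ≡ Δ g 0ℤ
    Δg-constant = periodic⇒constant dg λ x →
      cong₂ _-_ (trans (cong g (sym (+-shift (+ 2) x))) (period (1ℤ + x))) (period x)
    Δg0≡0 : Δ g 0ℤ ≡ 0ℤ
    Δg0≡0 = double≡0⇒≡0 (Δ g 0ℤ) (begin
      Δ g 0ℤ + Δ g 0ℤ  ≡⟨ cong (_+ Δ g 0ℤ) (Δg-constant 1ℤ) ⟨
      Δ g 1ℤ + Δ g 0ℤ  ≡⟨ telescope (g (+ 2)) (g 1ℤ) (g 0ℤ) ⟨
      g (+ 2) - g 0ℤ   ≡⟨ cong (_- g 0ℤ) (period 0ℤ) ⟩
      g 0ℤ - g 0ℤ      ≡⟨ ℤ.+-inverseʳ (g 0ℤ) ⟩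
      0ℤ               ∎)

  -- x ↦ g(x + 2) - g(x) has lower degree and vanishes on the same progression, so g is
  -- 2-periodic and hence constant.
  vanishes-on-progression : DegreeAtMost d g → ∀ c → (∀ k → g (+ (k ℕ.* 2 ℕ.+ c)) ≡ 0ℤ) →
                            ∀ x → g x ≡ 0ℤ
  vanishes-on-progression (constant gc) c zeros x = trans (gc x) (trans (sym (gc (+ c))) (zeros 0))
  vanishes-on-progression {g = g} dg@(difference Δdg) c zeros x = begin
    g x      ≡⟨ periodic⇒constant dg period x ⟩
    g 0ℤ     ≡⟨ periodic⇒constant dg period (+ c) ⟨
    g (+ c)  ≡⟨ zeros 0 ⟩
    0ℤ       ∎
    where
    open ≡-Reasoning
    Δ₂ : ℤ → ℤ
    Δ₂ x = g (+ 2 + x) - g x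
    Δ₂-split : ∀ x → Δ g (1ℤ + x) + Δ g x ≡ Δ₂ x
    Δ₂-split x = trans (sym (telescope (g (1ℤ + (1ℤ + x))) (g (1ℤ + x)) (g x)))
                       (cong (λ z → g z - g x) (sym (ℤ.+-assoc 1ℤ 1ℤ x)))
    period : ∀ x → g (+ 2 + x) ≡ g x
    period x = ℤ.i-j≡0⇒i≡j _ _
      (vanishes-on-progression (degree-cong Δ₂-split (degree-+ (degree-shift 1ℤ Δdg) Δdg)) c
        (λ k → cong₂ _-_ (zeros (suc k)) (zeros k)) x)

  isPolynomial-cong : (∀ x → g x ≡ h x) → IsPolynomial g → IsPolynomial h
  isPolynomial-cong g≗h (d , dg) = d , degree-cong g≗h dg

  isPolynomial-const : ∀ c → IsPolynomial (λ _ → c)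
  isPolynomial-const c = 0 , degree-const 0 c

  isPolynomial-id : IsPolynomial (λ x → x)
  isPolynomial-id = 1 , degree-id

  isPolynomial-+ : IsPolynomial f → IsPolynomial g → IsPolynomial (λ x → f x + g x)
  isPolynomial-+ (d , df) (e , dg) =
    d ⊔ e , degree-+ (degree-mono (ℕ.m≤m⊔n d e) df) (degree-mono (ℕ.m≤n⊔m d e) dg)

  isPolynomial-* : IsPolynomial f → IsPolynomial g → IsPolynomial (λ x → f x * g x)
  isPolynomial-* (d , df) (e , dg) = d ℕ.+ e , degree-* df dg

  isPolynomial-- : IsPolynomial f → IsPolynomial g → IsPolynomial (λ x → f x - g x)
  isPolynomial-- {f} {g} pf pg = isPolynomial-cong (λ x → cong (λ z → f x + z) (ℤ.-1*i≡-i (g x)))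
    (isPolynomial-+ pf (isPolynomial-* (isPolynomial-const -1ℤ) pg))

  isPolynomial-shift : ∀ c → IsPolynomial g → IsPolynomial (λ x → g (x + c))
  isPolynomial-shift {g} c (d , dg) = d , degree-cong (λ x → cong g (ℤ.+-comm c x)) (degree-shift c dg)

  record IsPolynomial₂ (F : ℤ → ℤ → ℤ) : Set where
    field
      inˣ : ∀ y → IsPolynomial (λ x → F x y)
      inʸ : ∀ x → IsPolynomial (λ y → F x y)
  open IsPolynomial₂

  isPolynomial₂-x : IsPolynomial₂ (λ x y → x)
  isPolynomial₂-x = record { inˣ = λ _ → isPolynomial-id ; inʸ = isPolynomial-const }

  isPolynomial₂-ʸ : IsPolynomial g → IsPolynomial₂ (λ x y → g y)
  isPolynomial₂-ʸ {g} pg = record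
    { inˣ = λ y → isPolynomial-const (g y)
    ; inʸ = λ _ → pg
    }

  isPolynomial₂-+ : IsPolynomial₂ F → IsPolynomial₂ G → IsPolynomial₂ (λ x y → F x y + G x y)
  isPolynomial₂-+ pF pG = record
    { inˣ = λ y → isPolynomial-+ (inˣ pF y) (inˣ pG y)
    ; inʸ = λ x → isPolynomial-+ (inʸ pF x) (inʸ pG x)
    }

  isPolynomial₂-- : IsPolynomial₂ F → IsPolynomial₂ G → IsPolynomial₂ (λ x y → F x y - G x y)
  isPolynomial₂-- pF pG = record
    { inˣ = λ y → isPolynomial-- (inˣ pF y) (inˣ pG y)
    ; inʸ = λ x → isPolynomial-- (inʸ pF x) (inʸ pG x)
    }

  isPolynomial₂-* : IsPolynomial₂ F → IsPolynomial₂ G → IsPolynomial₂ (λ x y → F x y * G x y)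
  isPolynomial₂-* pF pG = record
    { inˣ = λ y → isPolynomial-* (inˣ pF y) (inˣ pG y)
    ; inʸ = λ x → isPolynomial-* (inʸ pF x) (inʸ pG x)
    }

  isPolynomial₂-shiftˣ : ∀ a → IsPolynomial₂ F → IsPolynomial₂ (λ x y → F (x + a) y)
  isPolynomial₂-shiftˣ a pF = record
    { inˣ = λ y → isPolynomial-shift a (inˣ pF y)
    ; inʸ = λ x → inʸ pF (x + a)
    }

  isPolynomial₂-shiftʸ : ∀ b → IsPolynomial₂ F → IsPolynomial₂ (λ x y → F x (y + b))
  isPolynomial₂-shiftʸ b pF = record
    { inˣ = λ y → inˣ pF (y + b)
    ; inʸ = λ x → isPolynomial-shift b (inʸ pF x)
    }

  evalY-isPolynomial : ∀ q → IsPolynomial (evalY q)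
  evalY-isPolynomial []       = isPolynomial-const 0ℤ
  evalY-isPolynomial (c ∷ cs) =
    isPolynomial-+ (isPolynomial-const c) (isPolynomial-* isPolynomial-id (evalY-isPolynomial cs))

  eval-isPolynomial₂ : ∀ p → IsPolynomial₂ (eval p)
  eval-isPolynomial₂ []       = isPolynomial₂-ʸ (isPolynomial-const 0ℤ)
  eval-isPolynomial₂ (q ∷ qs) =
    isPolynomial₂-+ (isPolynomial₂-ʸ (evalY-isPolynomial q)) (isPolynomial₂-* isPolynomial₂-x (eval-isPolynomial₂ qs))

  private
    grid-point : ∀ k m r → k ℕ.* 2 ℕ.+ (m ℕ.+ r) ≡ m ℕ.+ (r ℕ.+ k ℕ.* 2)
    grid-point = ℕ.solve-∀

  vanishes-on-grid : IsPolynomial₂ F → ∀ {r} → r < 2 →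
                     (∀ l m → m ≤ l → (l ∸ m) % 2 ≡ r → F (+ l) (+ m) ≡ 0ℤ) →
                     ∀ x y → F x y ≡ 0ℤ
  vanishes-on-grid {F = F} pF {r} r<2 zeros x =
    vanishes-on-progression (proj₂ (inʸ pF x)) 0 (λ k → row (k ℕ.* 2 ℕ.+ 0) x)
    where
    row : ∀ m x → F x (+ m) ≡ 0ℤ
    row m = vanishes-on-progression (proj₂ (inˣ pF (+ m))) (m ℕ.+ r) λ k →
      zeros _ m
        (subst (m ≤_) (sym (grid-point k m r)) (ℕ.m≤m+n m _))
        (begin
          (k ℕ.* 2 ℕ.+ (m ℕ.+ r) ∸ m) % 2 ≡⟨ cong (λ l → (l ∸ m) % 2) (grid-point k m r) ⟩
          (m ℕ.+ (r ℕ.+ k ℕ.* 2) ∸ m) % 2 ≡⟨ cong (_% 2) (ℕ.m+n∸m≡n m _) ⟩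
          (r ℕ.+ k ℕ.* 2) % 2             ≡⟨ [m+kn]%n≡m%n r k 2 ⟩
          r % 2                           ≡⟨ m<n⇒m%n≡m r<2 ⟩
          r                               ∎)
      where open ≡-Reasoning

  ≡-on-grid⇒≡ : IsPolynomial₂ F → IsPolynomial₂ G → ∀ {r} → r < 2 →
                (∀ l m → m ≤ l → (l ∸ m) % 2 ≡ r → F (+ l) (+ m) ≡ G (+ l) (+ m)) →
                ∀ x y → F x y ≡ G x y
  ≡-on-grid⇒≡ pF pG r<2 agree x y = ℤ.i-j≡0⇒i≡j _ _
    (vanishes-on-grid (isPolynomial₂-- pF pG) r<2 (λ l m m≤l par → ℤ.i≡j⇒i-j≡0 (agree l m m≤l par)) x y)

module Counting where
  open import Data.Nat.Base as ℕ using (zero)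
  import Data.Nat.Properties as ℕ
  open import Data.Nat.ListAction using (sum)
  open import Algebra.Properties.CommutativeSemigroup ℕ.+-commutativeSemigroup using (interchange)
  open import Data.Integer.Base using (+_; -_)
  open import Data.Integer.Properties as ℤ using (_≟_)
  open import Data.Integer.Tactic.RingSolver using (solve-∀)
  open import Data.Fin.Base as Fin using (punchIn; punchOut)
  import Data.Fin.Properties as Fin
  import Data.Sign.Base as Sign
  open import Data.Maybe.Base using (just)
  open import Data.Bool.Base using (true; false)
  open import Data.List.Base using (List; []; _∷_; _++_; length; filter; map; concatMap)
  open import Data.List.Properties
    using (filter-++; length-++; length-map; map-cong; filter-≐; filter-accept; filter-reject; filter-none)
  import Data.List.Relation.Unary.All as All
  open import Data.List.Membership.Propositional using (_∈_)
  open import Data.List.Relation.Unary.Any using (here; there)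
  open import Data.Vec.Base using (Vec; lookup; insertAt) renaming (_∷_ to _∷ᵥ_)
  open import Data.Vec.Properties using (insertAt-lookup; insertAt-punchIn)
  import Data.Vec.Relation.Unary.All as Allᵥ
  open Allᵥ using (all?)
  open import Data.Vec.Relation.Unary.All.Properties using (lookup⁺; lookup⁻)
  open import Data.Product.Base using (_,_)
  open import Data.Unit.Base using (tt)
  open import Function.Base using (_∘_)
  open import Function.Bundles using (_⇔_; mk⇔; Equivalence)
  open import Level using (0ℓ)
  open import Relation.Nullary using (yes; no; ¬?; does; ¬_)
  open import Relation.Nullary.Decidable using (_×-dec_)
  open import Relation.Unary using (Pred; Decidable)
  open import Relation.Binary.PropositionalEquality

  private
    variable
      A B : Set
      P Q : Pred A 0ℓ
      n : ℕ

  length-filter-concatMap : (P? : Decidable P) (f : B → List A) (xs : List B) →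
    length (filter P? (concatMap f xs)) ≡ sum (map (λ x → length (filter P? (f x))) xs)
  length-filter-concatMap P? f []       = refl
  length-filter-concatMap P? f (x ∷ xs) = begin
    length (filter P? (f x ++ concatMap f xs))
      ≡⟨ cong length (filter-++ P? (f x) (concatMap f xs)) ⟩
    length (filter P? (f x) ++ filter P? (concatMap f xs))
      ≡⟨ length-++ (filter P? (f x)) ⟩
    length (filter P? (f x)) ℕ.+ length (filter P? (concatMap f xs))
      ≡⟨ cong (length (filter P? (f x)) ℕ.+_) (length-filter-concatMap P? f xs) ⟩
    length (filter P? (f x)) ℕ.+ sum (map (λ x → length (filter P? (f x))) xs)
      ∎
    where open ≡-Reasoning

  filter-map : (P? : Decidable P) (f : B → A) (xs : List B) →
    filter P? (map f xs) ≡ map f (filter (P? ∘ f) xs)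
  filter-map P? f []       = refl
  filter-map P? f (x ∷ xs) with does (P? (f x))
  ... | true  = cong (f x ∷_) (filter-map P? f xs)
  ... | false = filter-map P? f xs

  filter-×-dec : (P? : Decidable P) (Q? : Decidable Q) (xs : List A) →
    filter (λ x → P? x ×-dec Q? x) xs ≡ filter P? (filter Q? xs)
  filter-×-dec P? Q? []       = refl
  filter-×-dec P? Q? (x ∷ xs) with P? x | Q? x
  ... | yes px | yes _ = trans (cong (x ∷_) (filter-×-dec P? Q? xs)) (sym (filter-accept P? px))
  ... | no ¬px | yes _ = trans (filter-×-dec P? Q? xs) (sym (filter-reject P? ¬px))
  ... | yes _  | no _  = filter-×-dec P? Q? xs
  ... | no _   | no _  = filter-×-dec P? Q? xs

  sum-map-+ : (f g : A → ℕ) (xs : List A) →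
    sum (map (λ x → f x ℕ.+ g x) xs) ≡ sum (map f xs) ℕ.+ sum (map g xs)
  sum-map-+ f g []       = refl
  sum-map-+ f g (x ∷ xs) =
    trans (cong (f x ℕ.+ g x ℕ.+_) (sum-map-+ f g xs)) (interchange (f x) (g x) (sum (map f xs)) (sum (map g xs)))

  sum-map-zero : (xs : List A) → sum (map (λ _ → 0) xs) ≡ 0
  sum-map-zero []       = refl
  sum-map-zero (x ∷ xs) = sum-map-zero xs

  sum-map-swap : (F : A → B → ℕ) (xs : List A) (ys : List B) →
    sum (map (λ x → sum (map (F x) ys)) xs) ≡ sum (map (λ y → sum (map (λ x → F x y) xs)) ys)
  sum-map-swap F []       ys = sym (sum-map-zero ys)
  sum-map-swap F (x ∷ xs) ys =
    trans (cong (sum (map (F x) ys) ℕ.+_) (sum-map-swap F xs ys)) (sym (sum-map-+ (F x) _ ys))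

  private
    +-times : ∀ k a → k + a * k ≡ (1ℤ + a) * k
    +-times = solve-∀

  sum-map-constant : ∀ {f : A → ℕ} {xs} {k} → (∀ {x} → x ∈ xs → + f x ≡ k) →
                     + sum (map f xs) ≡ + length xs * k
  sum-map-constant {xs = []}     {k} _   = sym (ℤ.*-zeroˡ k)
  sum-map-constant {xs = x ∷ xs} {k} f≡k =
    trans (cong₂ _+_ (f≡k (here refl)) (sum-map-constant (f≡k ∘ there))) (+-times k (+ length xs))

  count-allMaps-suc : {P : Pred (Vec ℤ (suc n)) 0ℓ} (P? : Decidable P) (C : List ℤ) →
    length (filter P? (allMaps C (suc n))) ≡
    sum (map (λ c → length (filter (P? ∘ (c ∷ᵥ_)) (allMaps C n))) C)
  count-allMaps-suc {n} P? C =
    trans (length-filter-concatMap P? (λ c → map (c ∷ᵥ_) (allMaps C n)) C) (cong sum (map-cong row C))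
    where
    row : ∀ c → length (filter P? (map (c ∷ᵥ_) (allMaps C n))) ≡ length (filter (P? ∘ (c ∷ᵥ_)) (allMaps C n))
    row c = trans (cong length (filter-map P? (c ∷ᵥ_) (allMaps C n)))
                  (length-map (c ∷ᵥ_) (filter (P? ∘ (c ∷ᵥ_)) (allMaps C n)))

  count-allMaps-insertAt : {P : Pred (Vec ℤ (suc n)) 0ℓ} (P? : Decidable P) (C : List ℤ) (v : Fin (suc n)) →
    length (filter P? (allMaps C (suc n))) ≡
    sum (map (λ c → length (filter (λ w → P? (insertAt w v c)) (allMaps C n))) C)
  count-allMaps-insertAt P? C Fin.zero = count-allMaps-suc P? C
  count-allMaps-insertAt {suc n} P? C (Fin.suc v) = begin
    length (filter P? (allMaps C (2 ℕ.+ n)))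
      ≡⟨ count-allMaps-suc P? C ⟩
    sum (map (λ a → length (filter (P? ∘ (a ∷ᵥ_)) (allMaps C (suc n)))) C)
      ≡⟨ cong sum (map-cong (λ a → count-allMaps-insertAt (P? ∘ (a ∷ᵥ_)) C v) C) ⟩
    sum (map (λ a → sum (map (λ c → count a c) C)) C)
      ≡⟨ sum-map-swap count C C ⟩
    sum (map (λ c → sum (map (λ a → count a c) C)) C)
      ≡⟨ cong sum (map-cong (λ c → count-allMaps-suc (λ w → P? (insertAt w (Fin.suc v) c)) C) C) ⟨
    sum (map (λ c → length (filter (λ w → P? (insertAt w (Fin.suc v) c)) (allMaps C (suc n)))) C)
      ∎
    where
    open ≡-Reasoning
    count : ℤ → ℤ → ℕ
    count a c = length (filter (λ w → P? (a ∷ᵥ insertAt w v c)) (allMaps C n))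

  filter-all?-map-∷ : ∀ {c} (Q? : Decidable Q) → Q c → (ws : List (Vec ℤ n)) →
    filter (all? Q?) (map (c ∷ᵥ_) ws) ≡ map (c ∷ᵥ_) (filter (all? Q?) ws)
  filter-all?-map-∷ {c = c} Q? qc ws = trans (filter-map (all? Q?) (c ∷ᵥ_) ws)
    (cong (map (c ∷ᵥ_)) (filter-≐ (all? Q? ∘ (c ∷ᵥ_)) (all? Q?) ((λ { (_ Allᵥ.∷ qw) → qw }) , (qc Allᵥ.∷_)) ws))

  filter-all?-map-∷-reject : ∀ {c} (Q? : Decidable Q) → ¬ Q c → (ws : List (Vec ℤ n)) →
    filter (all? Q?) (map (c ∷ᵥ_) ws) ≡ []
  filter-all?-map-∷-reject {c = c} Q? ¬qc ws = trans (filter-map (all? Q?) (c ∷ᵥ_) ws)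
    (cong (map (c ∷ᵥ_))
          (filter-none (all? Q? ∘ (c ∷ᵥ_)) (All.universal (λ { _ (qc Allᵥ.∷ _) → ¬qc qc }) ws)))

  filter-allMaps : (Q? : Decidable Q) (C : List ℤ) (n : ℕ) →
    filter (all? Q?) (allMaps C n) ≡ allMaps (filter Q? C) n
  filter-allMaps Q? C zero    = refl
  filter-allMaps Q? C (suc n) = filter-rows C
    where
    filter-rows : ∀ D → filter (all? Q?) (concatMap (λ c → map (c ∷ᵥ_) (allMaps C n)) D)
                      ≡ concatMap (λ c → map (c ∷ᵥ_) (allMaps (filter Q? C) n)) (filter Q? D)
    filter-rows []      = refl
    filter-rows (c ∷ D) with Q? c
    ... | yes qc = trans (filter-++ (all? Q?) (map (c ∷ᵥ_) (allMaps C n)) _)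
                         (cong₂ _++_ (trans (filter-all?-map-∷ Q? qc (allMaps C n))
                                            (cong (map (c ∷ᵥ_)) (filter-allMaps Q? C n)))
                                     (filter-rows D))
    ... | no ¬qc = trans (filter-++ (all? Q?) (map (c ∷ᵥ_) (allMaps C n)) _)
                         (cong₂ _++_ (filter-all?-map-∷-reject Q? ¬qc (allMaps C n)) (filter-rows D))

  without : ℤ → List ℤ → List ℤ
  without a = filter (λ x → ¬? (x ≟ a))

  data VertexView (v : Fin (suc n)) : Fin (suc n) → Set where
    at-v  : VertexView v v
    other : ∀ i → VertexView v (punchIn v i)

  vertexView : (v i : Fin (suc n)) → VertexView v i
  vertexView v i with i Fin.≟ v
  ... | yes refl = at-v
  ... | no i≢v   = subst (VertexView v) (Fin.punchIn-punchOut v≢i) (other (punchOut v≢i))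
    where
    v≢i : v ≢ i
    v≢i = i≢v ∘ sym

  ≡-neg-sym : ∀ {a b} → a ≡ - b → b ≡ - a
  ≡-neg-sym {a} {b} a≡-b = trans (sym (ℤ.neg-involutive b)) (cong -_ (sym a≡-b))

  negativeEdgeOK⇔ : ∀ {a b} → EdgeOK (just Sign.-) a b ⇔ (a ≢ - b)
  negativeEdgeOK⇔ {a} {b} = mk⇔ (λ ok a≡-b → ok (trans a≡-b (sym (ℤ.-1*i≡-i b))))
                                 (λ a≢-b a≡-1*b → a≢-b (trans a≡-1*b (ℤ.-1*i≡-i b)))

  module _ (Σ : SignedGraph (suc n)) {v} (v-dominating : NegDominating Σ v) (w : Vec ℤ n) (c : ℤ) where
    private
      κ : Fin (suc n) → ℤ
      κ = lookup (insertAt w v c)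
      edge-from-v : ∀ i → edge Σ v (punchIn v i) ≡ just Sign.-
      edge-from-v i = v-dominating (punchIn v i) (Fin.punchInᵢ≢i v i)
      edge-to-v : ∀ i → edge Σ (punchIn v i) v ≡ just Sign.-
      edge-to-v i = trans (symmetric Σ (punchIn v i) v) (edge-from-v i)

    proper-insertAt⁻ : Proper Σ κ → Proper (deleteVertex Σ v) (lookup w) × Allᵥ.All (_≢ - c) w
    proper-insertAt⁻ proper = proper-w , lookup⁻ avoids-−c
      where
      proper-w : Proper (deleteVertex Σ v) (lookup w)
      proper-w i j = subst₂ (EdgeOK (edge Σ (punchIn v i) (punchIn v j)))
        (insertAt-punchIn w v c i) (insertAt-punchIn w v c j) (proper (punchIn v i) (punchIn v j))
      avoids-−c : ∀ i → lookup w i ≢ - c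
      avoids-−c i w≡-c = Equivalence.to negativeEdgeOK⇔
        (subst₂ (EdgeOK (just Sign.-)) (insertAt-lookup w v c) (insertAt-punchIn w v c i)
          (subst (λ e → EdgeOK e (κ v) (κ (punchIn v i))) (edge-from-v i) (proper v (punchIn v i))))
        (≡-neg-sym w≡-c)

    proper-insertAt⁺ : Proper (deleteVertex Σ v) (lookup w) → Allᵥ.All (_≢ - c) w → Proper Σ κ
    proper-insertAt⁺ proper avoids a b with vertexView v a | vertexView v b
    ... | at-v    | at-v    rewrite loopless Σ v = tt
    ... | at-v    | other j rewrite edge-from-v j | insertAt-lookup w v c | insertAt-punchIn w v c j =
      Equivalence.from negativeEdgeOK⇔ (lookup⁺ avoids j ∘ ≡-neg-sym)
    ... | other i | at-v    rewrite edge-to-v i | insertAt-lookup w v c | insertAt-punchIn w v c i =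
      Equivalence.from negativeEdgeOK⇔ (lookup⁺ avoids i)
    ... | other i | other j rewrite insertAt-punchIn w v c i | insertAt-punchIn w v c j = proper i j

  numColourings-split : (Σ : SignedGraph (suc n)) {v : Fin (suc n)} → NegDominating Σ v → ∀ C →
    numColourings Σ C ≡ sum (map (λ c → numColourings (deleteVertex Σ v) (without (- c) C)) C)
  numColourings-split {n} Σ {v} v-dominating C = begin
    numColourings Σ C
      ≡⟨ count-allMaps-insertAt (λ κ → proper? Σ (lookup κ)) C v ⟩
    sum (map (λ c → length (filter (λ w → proper? Σ (lookup (insertAt w v c))) (allMaps C n))) C)
      ≡⟨ cong sum (map-cong (cong length ∘ colourings-with-v-coloured) C) ⟩
    sum (map (λ c → numColourings Σ′ (without (- c) C)) C) ∎
    where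
    open ≡-Reasoning
    Σ′ : SignedGraph n
    Σ′ = deleteVertex Σ v
    colourings-with-v-coloured : ∀ c →
      filter (λ w → proper? Σ (lookup (insertAt w v c))) (allMaps C n) ≡
      filter (λ w → proper? Σ′ (lookup w)) (allMaps (without (- c) C) n)
    colourings-with-v-coloured c = begin
      filter (λ w → proper? Σ (lookup (insertAt w v c))) (allMaps C n)
        ≡⟨ filter-≐ _ (λ w → proper? Σ′ (lookup w) ×-dec all? avoid? w)
             ( (λ {w} → proper-insertAt⁻ Σ v-dominating w c)
             , (λ {w} (proper , avoids) → proper-insertAt⁺ Σ v-dominating w c proper avoids))
             (allMaps C n) ⟩
      filter (λ w → proper? Σ′ (lookup w) ×-dec all? avoid? w) (allMaps C n)
        ≡⟨ filter-×-dec _ _ (allMaps C n) ⟩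
      filter (λ w → proper? Σ′ (lookup w)) (filter (all? avoid?) (allMaps C n))
        ≡⟨ cong (filter _) (filter-allMaps avoid? C n) ⟩
      filter (λ w → proper? Σ′ (lookup w)) (allMaps (without (- c) C) n) ∎
      where
      avoid? : Decidable (_≢ - c)
      avoid? x = ¬? (x ≟ - c)

module ColourSets where
  open Counting using (without; ≡-neg-sym)
  open import Data.Nat.Base as ℕ using (zero; _≤_; _<_; _∸_; _%_; _/_)
  import Data.Nat.Properties as ℕ
  import Data.Nat.Tactic.RingSolver as ℕ
  open import Data.Nat.DivMod using ([m+kn]%n≡m%n; m≡m%n+[m/n]*n; m%n<n)
  open import Data.Nat.ListAction using (sum)
  open import Data.Nat.ListAction.Properties using (sum-↭; sum-++)
  open import Data.Integer.Base using (+_; -[1+_]; -_; 0ℤ)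
  open import Data.Integer.Properties as ℤ using (_≟_)
  open import Data.List.Base using (List; _∷_; _++_; length; map; applyUpTo)
  open import Data.List.Properties using (filter-all; map-++; length-++; length-applyUpTo)
  open import Data.List.Membership.Propositional using (_∈_; _∉_)
  open import Data.List.Membership.Propositional.Properties
    using (∈-filter⁺; ∈-filter⁻; ++-∈⇔; ∈-++⁺ˡ; ∈-++⁺ʳ; ∈-++⁻; ∈-applyUpTo⁺; ∈-applyUpTo⁻)
  open import Data.List.Membership.Propositional.Properties.WithK using (unique∧set⇒bag)
  open import Data.List.Relation.Binary.BagAndSetEquality using (∼bag⇒↭)
  open import Data.List.Relation.Binary.Disjoint.Propositional using (Disjoint)
  open import Data.List.Relation.Binary.Permutation.Propositional using (_↭_)
  open import Data.List.Relation.Binary.Permutation.Propositional.Properties using (↭-length; map⁺)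
  open import Data.List.Relation.Unary.Any using (here; there)
  open import Data.List.Relation.Unary.All as All using (All; _∷_)
  open import Data.List.Relation.Unary.AllPairs using (_∷_)
  open import Data.List.Relation.Unary.Unique.Propositional using (Unique)
  import Data.List.Relation.Unary.Unique.Propositional.Properties as Unique
  open import Data.Empty using (⊥)
  open import Data.Product.Base using (∃; _,_; proj₁; proj₂)
  open import Data.Sum.Base as Sum using (_⊎_; inj₁; inj₂; [_,_]′)
  open import Function.Base using (_∘_)
  open import Function.Bundles using (_⇔_; mk⇔; Equivalence)
  open import Function.Construct.Composition using (_⇔-∘_)
  open import Function.Construct.Symmetry using (⇔-sym)
  open import Relation.Nullary using (yes; no; ¬?; contradiction)
  open import Relation.Binary.PropositionalEquality

  private
    variable
      a c x : ℤ
      xs ys : List ℤ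

  ↭-from-∈⇔ : Unique xs → Unique ys → (∀ {x} → x ∈ xs ⇔ x ∈ ys) → xs ↭ ys
  ↭-from-∈⇔ xs! ys! xs≈ys = ∼bag⇒↭ (unique∧set⇒bag xs! ys! xs≈ys)

  ∈-without⁻ : x ∈ without a xs → x ∈ xs × x ≢ a
  ∈-without⁻ {a = a} = ∈-filter⁻ (λ x → ¬? (x ≟ a))

  ∈-without⁺ : x ∈ xs → x ≢ a → x ∈ without a xs
  ∈-without⁺ {a = a} = ∈-filter⁺ (λ x → ¬? (x ≟ a))

  without-unique : Unique xs → Unique (without a xs)
  without-unique {a = a} = Unique.filter⁺ (λ x → ¬? (x ≟ a))

  without-∉ : a ∉ xs → without a xs ≡ xs
  without-∉ {a = a} a∉xs =
    filter-all (λ x → ¬? (x ≟ a)) (All.tabulate λ x∈xs x≡a → a∉xs (subst (_∈ _) x≡a x∈xs))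

  ∈-0∷++⇔ : x ∈ 0ℤ ∷ (xs ++ ys) ⇔ (x ∈ xs ⊎ x ∈ ys ⊎ x ≡ 0ℤ)
  ∈-0∷++⇔ {x} {xs} {ys} = mk⇔ to from
    where
    to : x ∈ 0ℤ ∷ (xs ++ ys) → x ∈ xs ⊎ x ∈ ys ⊎ x ≡ 0ℤ
    to (here x≡0)        = inj₂ (inj₂ x≡0)
    to (there x∈xs++ys)  = Sum.map₂ inj₁ (∈-++⁻ xs x∈xs++ys)
    from : x ∈ xs ⊎ x ∈ ys ⊎ x ≡ 0ℤ → x ∈ 0ℤ ∷ (xs ++ ys)
    from (inj₁ x∈xs)        = there (∈-++⁺ˡ x∈xs)
    from (inj₂ (inj₁ x∈ys)) = there (∈-++⁺ʳ xs x∈ys)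
    from (inj₂ (inj₂ x≡0))  = here x≡0

  0∷++-unique : All (_≢ 0ℤ) xs → All (_≢ 0ℤ) ys → Unique xs → Unique ys → Disjoint xs ys →
                Unique (0ℤ ∷ (xs ++ ys))
  0∷++-unique {xs} xs≢0 ys≢0 xs! ys! xs∩ys≡∅ = All.tabulate 0∉xs++ys ∷ Unique.++⁺ xs! ys! xs∩ys≡∅
    where
    0∉xs++ys : x ∈ xs ++ _ → 0ℤ ≢ x
    0∉xs++ys x∈ 0≡x = [ All.lookup xs≢0 , All.lookup ys≢0 ]′ (∈-++⁻ xs x∈) (sym 0≡x)

  ≡-neg⇒≡0 : c ≡ - c → c ≡ 0ℤ
  ≡-neg⇒≡0 {+ zero}    _  = refl
  ≡-neg⇒≡0 {+ suc _}   ()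
  ≡-neg⇒≡0 { -[1+ _ ]} ()

  %2-+2 : ∀ k → (2 ℕ.+ k) % 2 ≡ k % 2
  %2-+2 k = trans (cong (_% 2) (ℕ.+-comm 2 k)) ([m+kn]%n≡m%n k 1 2)

  ∸2-%2 : ∀ {d} → 2 ≤ d → (d ∸ 2) % 2 ≡ d % 2
  ∸2-%2 (ℕ.s≤s (ℕ.s≤s {n = k} ℕ.z≤n)) = sym (%2-+2 k)

  odd⇒1≤ : ∀ d → d % 2 ≡ 1 → 1 ≤ d
  odd⇒1≤ zero    ()
  odd⇒1≤ (suc _) _ = ℕ.s≤s ℕ.z≤n

  odd⇒pred-even : ∀ d → d % 2 ≡ 1 → (d ∸ 1) % 2 ≡ 0
  odd⇒pred-even 0                   ()
  odd⇒pred-even 1                   _   = refl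
  odd⇒pred-even 2                   ()
  odd⇒pred-even (suc (suc (suc k))) odd =
    trans (%2-+2 k) (odd⇒pred-even (suc k) (trans (sym (%2-+2 (suc k))) odd))

  ∸-comm : ∀ l a b → l ∸ a ∸ b ≡ l ∸ b ∸ a
  ∸-comm l a b = trans (ℕ.∸-+-assoc l a b) (trans (cong (l ∸_) (ℕ.+-comm a b)) (sym (ℕ.∸-+-assoc l b a)))

  ∸1-∸suc : ∀ l m → l ∸ 1 ∸ suc m ≡ l ∸ m ∸ 2
  ∸1-∸suc l m = trans (sym (ℕ.∸-+-assoc (l ∸ 1) 1 m)) (trans (cong (_∸ m) (ℕ.∸-+-assoc l 1 1)) (∸-comm l 2 m))

  ≤-∸1 : ∀ {k l m} → m ≤ l → suc k ≤ l ∸ m → k ℕ.+ m ≤ l ∸ 1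
  ≤-∸1 {k} m≤l k<l∸m = ℕ.∸-monoˡ-≤ 1 (ℕ.m≤o∸n⇒m+n≤o (suc k) m≤l k<l∸m)

  paired-parity : ∀ l m → 2 ≤ l ∸ m → (l ∸ 1 ∸ suc m) % 2 ≡ (l ∸ m) % 2
  paired-parity l m 2≤l∸m = trans (cong (_% 2) (∸1-∸suc l m)) (∸2-%2 2≤l∸m)

  zero-parity : ∀ l m → (l ∸ m) % 2 ≡ 1 → (l ∸ 1 ∸ m) % 2 ≡ 0
  zero-parity l m odd = trans (cong (_% 2) (∸-comm l 1 m)) (odd⇒pred-even (l ∸ m) odd)

  module Canonical (m k : ℕ) where
    U P⁺ P⁻ P : List ℤ
    U  = applyUpTo (λ i → + suc i) m
    P⁺ = applyUpTo (λ j → + suc (m ℕ.+ j)) k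
    P⁻ = applyUpTo (λ j → -[1+ m ℕ.+ j ]) k
    P  = P⁺ ++ P⁻

    ∈U⁻ : x ∈ U → ∃ λ i → i < m × x ≡ + suc i
    ∈U⁻ = ∈-applyUpTo⁻ _

    ∈P⁻ : x ∈ P → ∃ λ j → j < k × (x ≡ + suc (m ℕ.+ j) ⊎ x ≡ -[1+ m ℕ.+ j ])
    ∈P⁻ x∈P with ∈-++⁻ P⁺ x∈P
    ... | inj₁ x∈P⁺ with j , j<k , x≡ ← ∈-applyUpTo⁻ _ x∈P⁺ = j , j<k , inj₁ x≡
    ... | inj₂ x∈P⁻ with j , j<k , x≡ ← ∈-applyUpTo⁻ _ x∈P⁻ = j , j<k , inj₂ x≡

    U-unique : Unique U
    U-unique = Unique.applyUpTo⁺₁ _ m λ i<j _ → ℕ.<⇒≢ i<j ∘ ℤ.+[1+-injective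

    P-unique : Unique P
    P-unique = Unique.++⁺
      (Unique.applyUpTo⁺₁ _ k λ i<j _ → ℕ.<⇒≢ i<j ∘ ℕ.+-cancelˡ-≡ m _ _ ∘ ℤ.+[1+-injective)
      (Unique.applyUpTo⁺₁ _ k λ i<j _ → ℕ.<⇒≢ i<j ∘ ℕ.+-cancelˡ-≡ m _ _ ∘ ℤ.-[1+-injective)
      λ (x∈P⁺ , x∈P⁻) → positive≢negative (∈-applyUpTo⁻ _ x∈P⁺) (∈-applyUpTo⁻ _ x∈P⁻)
      where
      positive≢negative : (∃ λ i → i < k × x ≡ + suc (m ℕ.+ i)) →
                          (∃ λ j → j < k × x ≡ -[1+ m ℕ.+ j ]) → ⊥
      positive≢negative (_ , _ , refl) (_ , _ , ())

    U-nonzero : All (_≢ 0ℤ) U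
    U-nonzero = All.tabulate (nonzero ∘ ∈U⁻)
      where
      nonzero : (∃ λ i → i < m × x ≡ + suc i) → x ≢ 0ℤ
      nonzero (_ , _ , refl) ()

    P-nonzero : All (_≢ 0ℤ) P
    P-nonzero = All.tabulate (nonzero ∘ ∈P⁻)
      where
      nonzero : (∃ λ j → j < k × (x ≡ + suc (m ℕ.+ j) ⊎ x ≡ -[1+ m ℕ.+ j ])) → x ≢ 0ℤ
      nonzero (_ , _ , inj₁ refl) ()
      nonzero (_ , _ , inj₂ refl) ()

    P-neg : x ∈ P → - x ∈ P
    P-neg x∈P with ∈P⁻ x∈P
    ... | j , j<k , inj₁ refl = ∈-++⁺ʳ P⁺ (∈-applyUpTo⁺ _ j<k)
    ... | j , j<k , inj₂ refl = ∈-++⁺ˡ (∈-applyUpTo⁺ _ j<k)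

    P-U-disj : x ∈ P → x ∉ U
    P-U-disj x∈P x∈U with ∈P⁻ x∈P | ∈U⁻ x∈U
    ... | j , _ , inj₁ refl | i , i<m , x≡ = ℕ.m+n≮m m j (subst (_< m) (sym (ℤ.+[1+-injective x≡)) i<m)
    ... | _ , _ , inj₂ refl | _ , _ , ()

    P-U-disjoint : Disjoint P U
    P-U-disjoint (x∈P , x∈U) = P-U-disj x∈P x∈U

    U-neg : x ∈ U → - x ∉ U
    U-neg x∈U -x∈U with ∈U⁻ x∈U
    ... | _ , _ , refl with ∈U⁻ -x∈U
    ...   | _ , _ , ()

    length-P : length P ≡ k ℕ.* 2
    length-P = begin
      length (P⁺ ++ P⁻)        ≡⟨ length-++ P⁺ ⟩
      length P⁺ ℕ.+ length P⁻  ≡⟨ cong₂ ℕ._+_ (length-applyUpTo _ k) (length-applyUpTo _ k) ⟩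
      k ℕ.+ k                  ≡⟨ cong (k ℕ.+_) (ℕ.+-identityʳ k) ⟨
      2 ℕ.* k                  ≡⟨ ℕ.*-comm 2 k ⟩
      k ℕ.* 2                  ∎
      where open ≡-Reasoning

  -- No hypothesis m ≤ l is needed: for l < m, l ∸ m = 0 and P = [] satisfies the even shape.
  colourSet-exists : ∀ l m → ∃ (ColourSet l m)
  colourSet-exists l m with (l ∸ m) % 2 in parity | m%n<n (l ∸ m) 2
  ... | 0 | _ = P ++ U , record
    { P = P ; U = U
    ; C-unique = Unique.++⁺ P-unique U-unique P-U-disjoint
    ; P-unique = P-unique ; U-unique = U-unique ; P-nonzero = P-nonzero ; U-nonzero = U-nonzero
    ; P-neg = P-neg ; P-U-disj = P-U-disj ; U-neg = U-neg ; U-size = length-applyUpTo _ m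
    ; shape = inj₁ (parity , trans length-P (sym l∸m≡k*2) , λ _ → ++-∈⇔)
    }
    where
    open Canonical m ((l ∸ m) / 2)
    l∸m≡k*2 : l ∸ m ≡ (l ∸ m) / 2 ℕ.* 2
    l∸m≡k*2 = trans (m≡m%n+[m/n]*n (l ∸ m) 2) (cong (ℕ._+ (l ∸ m) / 2 ℕ.* 2) parity)
  ... | 1 | _ = 0ℤ ∷ (P ++ U) , record
    { P = P ; U = U
    ; C-unique = 0∷++-unique P-nonzero U-nonzero P-unique U-unique P-U-disjoint
    ; P-unique = P-unique ; U-unique = U-unique ; P-nonzero = P-nonzero ; U-nonzero = U-nonzero
    ; P-neg = P-neg ; P-U-disj = P-U-disj ; U-neg = U-neg ; U-size = length-applyUpTo _ m
    ; shape = inj₂ (parity , trans length-P (sym (cong (_∸ 1) l∸m≡1+k*2)) , λ _ → ∈-0∷++⇔)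
    }
    where
    open Canonical m ((l ∸ m) / 2)
    l∸m≡1+k*2 : l ∸ m ≡ 1 ℕ.+ (l ∸ m) / 2 ℕ.* 2
    l∸m≡1+k*2 = trans (m≡m%n+[m/n]*n (l ∸ m) 2) (cong (ℕ._+ (l ∸ m) / 2 ℕ.* 2) parity)
  ... | suc (suc _) | ℕ.s≤s (ℕ.s≤s ())

  module _ {l m C} (cs : ColourSet l m C) where
    open ColourSet cs

    paired-nonzero : c ∈ P → c ≢ 0ℤ
    paired-nonzero = All.lookup P-nonzero

    unpaired-nonzero : c ∈ U → c ≢ 0ℤ
    unpaired-nonzero = All.lookup U-nonzero

    P-U-disjoint : Disjoint P U
    P-U-disjoint (x∈P , x∈U) = P-U-disj x∈P x∈U

    colour-cases : c ∈ C → c ∈ P ⊎ c ∈ U ⊎ c ≡ 0ℤ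
    colour-cases c∈C with shape
    ... | inj₁ (_ , _ , ∈C⇔) = Sum.map₂ inj₁ (Equivalence.to (∈C⇔ _) c∈C)
    ... | inj₂ (_ , _ , ∈C⇔) = Equivalence.to (∈C⇔ _) c∈C

    length-P≤ : length P ≤ l ∸ m
    length-P≤ with shape
    ... | inj₁ (_ , |P|≡d , _)   = ℕ.≤-reflexive |P|≡d
    ... | inj₂ (_ , |P|≡d∸1 , _) = ℕ.≤-trans (ℕ.≤-reflexive |P|≡d∸1) (ℕ.m∸n≤m (l ∸ m) 1)

    even-shape : (l ∸ m) % 2 ≡ 0 → length P ≡ l ∸ m × (∀ x → x ∈ C ⇔ (x ∈ P ⊎ x ∈ U))
    even-shape even with shape
    ... | inj₁ (_ , |P|≡d , ∈C⇔) = |P|≡d , ∈C⇔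
    ... | inj₂ (odd , _)          = contradiction (trans (sym even) odd) λ ()

    odd-shape : (l ∸ m) % 2 ≡ 1 → length P ≡ l ∸ m ∸ 1 × (∀ x → x ∈ C ⇔ (x ∈ P ⊎ x ∈ U ⊎ x ≡ 0ℤ))
    odd-shape odd with shape
    ... | inj₁ (even , _)           = contradiction (trans (sym even) odd) λ ()
    ... | inj₂ (_ , |P|≡d∸1 , ∈C⇔) = |P|≡d∸1 , ∈C⇔

    sum-even : (l ∸ m) % 2 ≡ 0 → (G : ℤ → ℕ) → sum (map G C) ≡ sum (map G U) ℕ.+ sum (map G P)
    sum-even even G = begin
      sum (map G C)                    ≡⟨ sum-↭ (map⁺ G C↭P++U) ⟩
      sum (map G (P ++ U))             ≡⟨ cong sum (map-++ G P U) ⟩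
      sum (map G P ++ map G U)         ≡⟨ sum-++ (map G P) (map G U) ⟩
      sum (map G P) ℕ.+ sum (map G U)  ≡⟨ ℕ.+-comm (sum (map G P)) (sum (map G U)) ⟩
      sum (map G U) ℕ.+ sum (map G P)  ∎
      where
      open ≡-Reasoning
      C↭P++U : C ↭ P ++ U
      C↭P++U = ↭-from-∈⇔ C-unique (Unique.++⁺ P-unique U-unique P-U-disjoint)
        (⇔-sym ++-∈⇔ ⇔-∘ proj₂ (even-shape even) _)

    sum-odd : (l ∸ m) % 2 ≡ 1 → (G : ℤ → ℕ) → sum (map G C) ≡ sum (map G U) ℕ.+ sum (map G P) ℕ.+ G 0ℤ
    sum-odd odd G = begin
      sum (map G C)                                ≡⟨ sum-↭ (map⁺ G C↭0∷P++U) ⟩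
      G 0ℤ ℕ.+ sum (map G (P ++ U))                ≡⟨ cong (λ s → G 0ℤ ℕ.+ sum s) (map-++ G P U) ⟩
      G 0ℤ ℕ.+ sum (map G P ++ map G U)            ≡⟨ cong (G 0ℤ ℕ.+_) (sum-++ (map G P) (map G U)) ⟩
      G 0ℤ ℕ.+ (sum (map G P) ℕ.+ sum (map G U))   ≡⟨ reverse (G 0ℤ) (sum (map G P)) (sum (map G U)) ⟩
      sum (map G U) ℕ.+ sum (map G P) ℕ.+ G 0ℤ     ∎
      where
      open ≡-Reasoning
      reverse : ∀ a b c → a ℕ.+ (b ℕ.+ c) ≡ c ℕ.+ b ℕ.+ a
      reverse = ℕ.solve-∀
      C↭0∷P++U : C ↭ 0ℤ ∷ (P ++ U)
      C↭0∷P++U = ↭-from-∈⇔ C-unique (0∷++-unique P-nonzero U-nonzero P-unique U-unique P-U-disjoint)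
        (⇔-sym ∈-0∷++⇔ ⇔-∘ proj₂ (odd-shape odd) _)

    neg-unpaired∉ : c ∈ U → - c ∉ C
    neg-unpaired∉ {c} c∈U -c∈C with colour-cases -c∈C
    ... | inj₁ -c∈P        = P-U-disj (subst (_∈ P) (ℤ.neg-involutive c) (P-neg -c∈P)) c∈U
    ... | inj₂ (inj₁ -c∈U) = U-neg c∈U -c∈U
    ... | inj₂ (inj₂ -c≡0) = unpaired-nonzero c∈U (ℤ.neg-injective -c≡0)

    colourSet-without0 : (l ∸ m) % 2 ≡ 1 → ColourSet (l ∸ 1) m (without 0ℤ C)
    colourSet-without0 odd = record
      { P = P ; U = U
      ; C-unique = without-unique C-unique ; P-unique = P-unique ; U-unique = U-unique
      ; P-nonzero = P-nonzero ; U-nonzero = U-nonzero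
      ; P-neg = P-neg ; P-U-disj = P-U-disj ; U-neg = U-neg
      ; U-size = U-size
      ; shape = inj₁ (zero-parity l m odd , trans (proj₁ (odd-shape odd)) (∸-comm l m 1) , λ x → mk⇔ to from)
      }
      where
      to : x ∈ without 0ℤ C → x ∈ P ⊎ x ∈ U
      to x∈ with ∈-without⁻ x∈
      ... | x∈C , x≢0 with Equivalence.to (proj₂ (odd-shape odd) _) x∈C
      ...   | inj₁ x∈P        = inj₁ x∈P
      ...   | inj₂ (inj₁ x∈U) = inj₂ x∈U
      ...   | inj₂ (inj₂ x≡0) = contradiction x≡0 x≢0
      from : x ∈ P ⊎ x ∈ U → x ∈ without 0ℤ C
      from x∈ = ∈-without⁺ (Equivalence.from (proj₂ (odd-shape odd) _) (Sum.map₂ inj₁ x∈))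
                           ([ paired-nonzero , unpaired-nonzero ]′ x∈)

    module Paired {c} (c∈P : c ∈ P) where
      P′ : List ℤ
      P′ = without c (without (- c) P)

      U′ : List ℤ
      U′ = c ∷ U

      c≢-c : c ≢ - c
      c≢-c = paired-nonzero c∈P ∘ ≡-neg⇒≡0

      -c∈P : - c ∈ P
      -c∈P = P-neg c∈P

      ∈P′⁻ : x ∈ P′ → x ∈ P × x ≢ - c × x ≢ c
      ∈P′⁻ x∈P′ with ∈-without⁻ x∈P′
      ... | x∈ , x≢c with ∈-without⁻ x∈
      ...   | x∈P , x≢-c = x∈P , x≢-c , x≢c

      ∈P′⁺ : x ∈ P → x ≢ - c → x ≢ c → x ∈ P′
      ∈P′⁺ x∈P x≢-c x≢c = ∈-without⁺ (∈-without⁺ x∈P x≢-c) x≢c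

      P′-unique : Unique P′
      P′-unique = without-unique (without-unique P-unique)

      U′-unique : Unique U′
      U′-unique = All.tabulate (λ x∈U c≡x → P-U-disj c∈P (subst (_∈ U) (sym c≡x) x∈U)) ∷ U-unique

      P′-neg : x ∈ P′ → - x ∈ P′
      P′-neg x∈P′ with ∈P′⁻ x∈P′
      ... | x∈P , x≢-c , x≢c = ∈P′⁺ (P-neg x∈P) (x≢c ∘ ℤ.neg-injective) (x≢-c ∘ ≡-neg-sym ∘ sym)

      P′-U′-disj : x ∈ P′ → x ∉ U′
      P′-U′-disj x∈P′ (here x≡c)  = proj₂ (proj₂ (∈P′⁻ x∈P′)) x≡c
      P′-U′-disj x∈P′ (there x∈U) = P-U-disj (proj₁ (∈P′⁻ x∈P′)) x∈U

      U′-neg : x ∈ U′ → - x ∉ U′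
      U′-neg (here refl)  (here -c≡c)   = c≢-c (sym -c≡c)
      U′-neg (here refl)  (there -c∈U)  = P-U-disj -c∈P -c∈U
      U′-neg (there x∈U) (here -x≡c)   = P-U-disj (subst (_∈ P) (sym (≡-neg-sym (sym -x≡c))) -c∈P) x∈U
      U′-neg (there x∈U) (there -x∈U)  = U-neg x∈U -x∈U

      P↭c∷-c∷P′ : P ↭ c ∷ - c ∷ P′
      P↭c∷-c∷P′ = ↭-from-∈⇔ P-unique c∷-c∷P′-unique (mk⇔ to from)
        where
        c∷-c∷P′-unique : Unique (c ∷ - c ∷ P′)
        c∷-c∷P′-unique = (c≢-c ∷ All.tabulate (λ x∈P′ c≡x → proj₂ (proj₂ (∈P′⁻ x∈P′)) (sym c≡x)))
                       ∷ All.tabulate (λ x∈P′ -c≡x → proj₁ (proj₂ (∈P′⁻ x∈P′)) (sym -c≡x)) ∷ P′-unique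
        to : x ∈ P → x ∈ c ∷ - c ∷ P′
        to {x} x∈P with x ≟ c | x ≟ - c
        ... | yes x≡c | _        = here x≡c
        ... | no _    | yes x≡-c = there (here x≡-c)
        ... | no x≢c  | no x≢-c  = there (there (∈P′⁺ x∈P x≢-c x≢c))
        from : x ∈ c ∷ - c ∷ P′ → x ∈ P
        from (here refl)          = c∈P
        from (there (here refl))  = -c∈P
        from (there (there x∈P′)) = proj₁ (∈P′⁻ x∈P′)

      length-P : length P ≡ 2 ℕ.+ length P′
      length-P = ↭-length P↭c∷-c∷P′

      2≤l∸m : 2 ≤ l ∸ m
      2≤l∸m = ℕ.≤-trans (ℕ.≤-trans (ℕ.m≤m+n 2 (length P′)) (ℕ.≤-reflexive (sym length-P))) length-P≤

      classify : x ∈ P → x ≢ - c → x ∈ P′ ⊎ x ≡ c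
      classify {x} x∈P x≢-c with x ≟ c
      ... | yes x≡c = inj₂ x≡c
      ... | no x≢c  = inj₁ (∈P′⁺ x∈P x≢-c x≢c)

      old-colour : x ∈ P′ ⊎ x ∈ U′ → x ∈ P ⊎ x ∈ U
      old-colour (inj₁ x∈P′)        = inj₁ (proj₁ (∈P′⁻ x∈P′))
      old-colour (inj₂ (here refl)) = inj₁ c∈P
      old-colour (inj₂ (there x∈U)) = inj₂ x∈U

      new-colour≢-c : x ∈ P′ ⊎ x ∈ U′ → x ≢ - c
      new-colour≢-c (inj₁ x∈P′)              = proj₁ (proj₂ (∈P′⁻ x∈P′))
      new-colour≢-c (inj₂ (here refl))       = c≢-c
      new-colour≢-c (inj₂ (there x∈U)) x≡-c = P-U-disj -c∈P (subst (_∈ U) x≡-c x∈U)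

      ∈-without-even : (∀ x → x ∈ C ⇔ (x ∈ P ⊎ x ∈ U)) → ∀ x → x ∈ without (- c) C ⇔ (x ∈ P′ ⊎ x ∈ U′)
      ∈-without-even ∈C⇔ x = mk⇔ to from
        where
        to : x ∈ without (- c) C → x ∈ P′ ⊎ x ∈ U′
        to x∈ with ∈-without⁻ x∈
        ... | x∈C , x≢-c with Equivalence.to (∈C⇔ x) x∈C
        ...   | inj₁ x∈P = Sum.map₂ here (classify x∈P x≢-c)
        ...   | inj₂ x∈U = inj₂ (there x∈U)
        from : x ∈ P′ ⊎ x ∈ U′ → x ∈ without (- c) C
        from x∈ = ∈-without⁺ (Equivalence.from (∈C⇔ x) (old-colour x∈)) (new-colour≢-c x∈)

      ∈-without-odd : (∀ x → x ∈ C ⇔ (x ∈ P ⊎ x ∈ U ⊎ x ≡ 0ℤ)) →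
                      ∀ x → x ∈ without (- c) C ⇔ (x ∈ P′ ⊎ x ∈ U′ ⊎ x ≡ 0ℤ)
      ∈-without-odd ∈C⇔ x = mk⇔ to from
        where
        to : x ∈ without (- c) C → x ∈ P′ ⊎ x ∈ U′ ⊎ x ≡ 0ℤ
        to x∈ with ∈-without⁻ x∈
        ... | x∈C , x≢-c with Equivalence.to (∈C⇔ x) x∈C
        ...   | inj₁ x∈P        = Sum.map₂ (inj₁ ∘ here) (classify x∈P x≢-c)
        ...   | inj₂ (inj₁ x∈U) = inj₂ (inj₁ (there x∈U))
        ...   | inj₂ (inj₂ x≡0) = inj₂ (inj₂ x≡0)
        from-new : x ∈ P′ ⊎ x ∈ U′ → x ∈ without (- c) C
        from-new x∈ = ∈-without⁺ (Equivalence.from (∈C⇔ x) (Sum.map₂ inj₁ (old-colour x∈))) (new-colour≢-c x∈)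
        from : x ∈ P′ ⊎ x ∈ U′ ⊎ x ≡ 0ℤ → x ∈ without (- c) C
        from (inj₁ x∈P′)        = from-new (inj₁ x∈P′)
        from (inj₂ (inj₁ x∈U′)) = from-new (inj₂ x∈U′)
        from (inj₂ (inj₂ refl)) = ∈-without⁺ (Equivalence.from (∈C⇔ x) (inj₂ (inj₂ refl)))
                                             (paired-nonzero c∈P ∘ ℤ.neg-injective ∘ sym)

      colourSet : ColourSet (l ∸ 1) (suc m) (without (- c) C)
      colourSet = record
        { P = P′ ; U = U′
        ; C-unique = without-unique C-unique ; P-unique = P′-unique ; U-unique = U′-unique
        ; P-nonzero = All.tabulate (paired-nonzero ∘ proj₁ ∘ ∈P′⁻)
        ; U-nonzero = paired-nonzero c∈P ∷ U-nonzero
        ; P-neg = P′-neg ; P-U-disj = P′-U′-disj ; U-neg = U′-neg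
        ; U-size = cong suc U-size
        ; shape = Sum.map
            (λ (even , |P|≡d , ∈C⇔) →
              trans (paired-parity l m 2≤l∸m) even
              , sym (trans (∸1-∸suc l m) (cong (_∸ 2) (trans (sym |P|≡d) length-P)))
              , ∈-without-even ∈C⇔)
            (λ (odd , |P|≡d∸1 , ∈C⇔) →
              trans (paired-parity l m 2≤l∸m) odd
              , sym (trans (cong (_∸ 1) (∸1-∸suc l m))
                      (trans (∸-comm (l ∸ m) 2 1) (cong (_∸ 2) (trans (sym |P|≡d∸1) length-P))))
              , ∈-without-odd ∈C⇔)
            shape
        }

module Recurrence {n} (Σ : SignedGraph (suc n)) {v : Fin (suc n)} (v-dominating : NegDominating Σ v) where
  open Counting using (without; sum-map-constant; numColourings-split)
  open ColourSets
  open import Data.Nat.Base as ℕ using (_≤_; _∸_; _%_)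
  import Data.Nat.Properties as ℕ
  open import Data.Nat.ListAction using (sum)
  open import Data.Integer.Base using (+_; -_; 0ℤ)
  import Data.Integer.Properties as ℤ
  open import Data.List.Base using (length; map)
  open import Data.List.Membership.Propositional using (_∈_)
  open import Data.Product.Base using (proj₁)
  open import Function.Base using (_∘_)
  open import Relation.Binary.PropositionalEquality

  Σ′ : SignedGraph n
  Σ′ = deleteVertex Σ v

  CountsColourings : ℕ → Poly2 → Set
  CountsColourings r F = ∀ l m → m ≤ l → (l ∸ m) % 2 ≡ r → ∀ C → ColourSet l m C →
                         + numColourings Σ′ C ≡ eval F (+ l) (+ m)

  +-∸ : ∀ {l k} → k ≤ l → + (l ∸ k) ≡ + l - + k
  +-∸ {l} {k} k≤l = trans (sym (ℤ.⊖-≥ k≤l)) (sym (ℤ.m-n≡m⊖n l k))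

  +-∸1 : ∀ {k} l m → suc k ≤ l ∸ m → + (l ∸ 1) ≡ + l - 1ℤ
  +-∸1 l m k<l∸m = +-∸ (ℕ.≤-trans (ℕ.s≤s ℕ.z≤n) (ℕ.≤-trans k<l∸m (ℕ.m∸n≤m l m)))

  module _ {l m C} (m≤l : m ≤ l) (cs : ColourSet l m C) where
    open ColourSet cs

    summand : ℤ → ℕ
    summand c = numColourings Σ′ (without (- c) C)

    unpaired-summand : ∀ {r} F → CountsColourings r F → (l ∸ m) % 2 ≡ r →
                       ∀ {c} → c ∈ U → + summand c ≡ eval F (+ l) (+ m)
    unpaired-summand F F-counts parity c∈U =
      trans (cong (+_ ∘ numColourings Σ′) (without-∉ (neg-unpaired∉ cs c∈U))) (F-counts l m m≤l parity C cs)

    paired-summand : ∀ {r} F → CountsColourings r F → (l ∸ m) % 2 ≡ r →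
                     ∀ {c} → c ∈ P → + summand c ≡ eval F (+ l - 1ℤ) (+ m + 1ℤ)
    paired-summand F F-counts parity c∈P = trans
      (F-counts (l ∸ 1) (suc m) (≤-∸1 m≤l 2≤l∸m) (trans (paired-parity l m 2≤l∸m) parity) _ colourSet)
      (cong₂ (eval F) (+-∸1 l m 2≤l∸m) (cong +_ (ℕ.+-comm 1 m)))
      where open Paired cs c∈P

    zero-summand : ∀ E′ → CountsColourings 0 E′ → (l ∸ m) % 2 ≡ 1 → + summand 0ℤ ≡ eval E′ (+ l - 1ℤ) (+ m)
    zero-summand E′ E′-counts odd = trans
      (E′-counts (l ∸ 1) m (≤-∸1 m≤l (odd⇒1≤ (l ∸ m) odd)) (zero-parity l m odd)
                 _ (colourSet-without0 cs odd))
      (cong (λ x → eval E′ x (+ m)) (+-∸1 l m (odd⇒1≤ (l ∸ m) odd)))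

    numColourings-even : ∀ E′ → CountsColourings 0 E′ → (l ∸ m) % 2 ≡ 0 →
      + numColourings Σ C ≡ + m * eval E′ (+ l) (+ m) + (+ l - + m) * eval E′ (+ l - 1ℤ) (+ m + 1ℤ)
    numColourings-even E′ E′-counts even = begin
      + numColourings Σ C
        ≡⟨ cong +_ (trans (numColourings-split Σ v-dominating C) (sum-even cs even summand)) ⟩
      + sum (map summand U) + + sum (map summand P)
        ≡⟨ cong₂ _+_ (sum-map-constant (unpaired-summand E′ E′-counts even))
                     (sum-map-constant (paired-summand E′ E′-counts even)) ⟩
      + length U * a + + length P * b
        ≡⟨ cong₂ (λ u p → u * a + p * b) (cong +_ U-size) (trans (cong +_ (proj₁ (even-shape cs even))) (+-∸ m≤l)) ⟩
      + m * a + (+ l - + m) * b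
        ∎
      where
      open ≡-Reasoning
      a b : ℤ
      a = eval E′ (+ l) (+ m)
      b = eval E′ (+ l - 1ℤ) (+ m + 1ℤ)

    numColourings-odd : ∀ E′ O′ → CountsColourings 0 E′ → CountsColourings 1 O′ → (l ∸ m) % 2 ≡ 1 →
      + numColourings Σ C ≡ + m * eval O′ (+ l) (+ m) + (+ l - + m - 1ℤ) * eval O′ (+ l - 1ℤ) (+ m + 1ℤ)
                            + eval E′ (+ l - 1ℤ) (+ m)
    numColourings-odd E′ O′ E′-counts O′-counts odd = begin
      + numColourings Σ C
        ≡⟨ cong +_ (trans (numColourings-split Σ v-dominating C) (sum-odd cs odd summand)) ⟩
      + sum (map summand U) + + sum (map summand P) + + summand 0ℤ
        ≡⟨ cong₂ _+_ (cong₂ _+_ (sum-map-constant (unpaired-summand O′ O′-counts odd))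
                                 (sum-map-constant (paired-summand O′ O′-counts odd)))
                     (zero-summand E′ E′-counts odd) ⟩
      + length U * a + + length P * b + z
        ≡⟨ cong₂ (λ u p → u * a + p * b + z) (cong +_ U-size) |P|≡l-m-1 ⟩
      + m * a + (+ l - + m - 1ℤ) * b + z
        ∎
      where
      open ≡-Reasoning
      a b z : ℤ
      a = eval O′ (+ l) (+ m)
      b = eval O′ (+ l - 1ℤ) (+ m + 1ℤ)
      z = eval E′ (+ l - 1ℤ) (+ m)
      |P|≡l-m-1 : + length P ≡ + l - + m - 1ℤ
      |P|≡l-m-1 = begin
        + length P        ≡⟨ cong +_ (proj₁ (odd-shape cs odd)) ⟩
        + (l ∸ m ∸ 1)     ≡⟨ +-∸ (odd⇒1≤ (l ∸ m) odd) ⟩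
        + (l ∸ m) - 1ℤ    ≡⟨ cong (_- 1ℤ) (+-∸ m≤l) ⟩
        + l - + m - 1ℤ    ∎

open PolynomialFunction
open ColourSets using (colourSet-exists)
open Recurrence using (numColourings-even; numColourings-odd)

recurrenceE-isPolynomial₂ : ∀ E′ →
  IsPolynomial₂ (λ x y → y * eval E′ x y + (x - y) * eval E′ (x - 1ℤ) (y + 1ℤ))
recurrenceE-isPolynomial₂ E′ =
  isPolynomial₂-+ (isPolynomial₂-* (isPolynomial₂-ʸ isPolynomial-id) (eval-isPolynomial₂ E′))
    (isPolynomial₂-* (isPolynomial₂-- isPolynomial₂-x (isPolynomial₂-ʸ isPolynomial-id))
                     (isPolynomial₂-shiftˣ _ (isPolynomial₂-shiftʸ 1ℤ (eval-isPolynomial₂ E′))))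

recurrenceO-isPolynomial₂ : ∀ E′ O′ → IsPolynomial₂ (λ x y →
  y * eval O′ x y + (x - y - 1ℤ) * eval O′ (x - 1ℤ) (y + 1ℤ) + eval E′ (x - 1ℤ) y)
recurrenceO-isPolynomial₂ E′ O′ =
  isPolynomial₂-+
    (isPolynomial₂-+ (isPolynomial₂-* (isPolynomial₂-ʸ isPolynomial-id) (eval-isPolynomial₂ O′))
      (isPolynomial₂-* (isPolynomial₂-- (isPolynomial₂-- isPolynomial₂-x (isPolynomial₂-ʸ isPolynomial-id))
                                         (isPolynomial₂-ʸ (isPolynomial-const 1ℤ)))
                       (isPolynomial₂-shiftˣ _ (isPolynomial₂-shiftʸ 1ℤ (eval-isPolynomial₂ O′)))))
    (isPolynomial₂-shiftˣ _ (eval-isPolynomial₂ E′))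

proposition4p10 : ∀ {n : ℕ} (Σ : SignedGraph (suc n)) (v : Fin (suc n)) →
    NegDominating Σ v →
    ∀ (E O E′ O′ : Poly2) →
    IsE Σ E → IsO Σ O → IsE (deleteVertex Σ v) E′ → IsO (deleteVertex Σ v) O′ →
    (∀ (x y : ℤ) →
      eval E x y ≡ y * eval E′ x y + (x - y) * eval E′ (x - 1ℤ) (y + 1ℤ))
    ×
    (∀ (x y : ℤ) →
      eval O x y ≡ y * eval O′ x y + (x - y - 1ℤ) * eval O′ (x - 1ℤ) (y + 1ℤ)
                   + eval E′ (x - 1ℤ) y)
proposition4p10 Σ v v-dominating E O E′ O′ E-counts O-counts E′-counts O′-counts =
  ≡-on-grid⇒≡ (eval-isPolynomial₂ E) (recurrenceE-isPolynomial₂ E′) (s≤s z≤n) (λ l m m≤l even →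
    let C , cs = colourSet-exists l m in
    trans (sym (E-counts l m m≤l even C cs)) (numColourings-even Σ v-dominating m≤l cs E′ E′-counts even))
  ,
  ≡-on-grid⇒≡ (eval-isPolynomial₂ O) (recurrenceO-isPolynomial₂ E′ O′) (s≤s (s≤s z≤n)) (λ l m m≤l odd →
    let C , cs = colourSet-exists l m in
    trans (sym (O-counts l m m≤l odd C cs))
          (numColourings-odd Σ v-dominating m≤l cs E′ O′ E′-counts O′-counts odd))
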